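{- Let $\mathcal{S}\subseteq 2^{[n]}$ and let $\bar m\ge1$ be an integer. Define $\mathcal{S}'\subseteq 2^{[n]\times[\bar m]}$ by $\mathcal{S}'=\{s':s\in\mathcal{S}\}$, where $s'=\{(i,j): i\in s,\ j\in[\bar m]\}$. Then $\mathrm{HHdim}(\mathcal{S}')=\mathrm{HHdim}(\mathcal{S})$.
   Context: For a set system $\mathcal{T}$ over a finite ground set $N$ (sets identified with $0/1$ vectors in $\{0,1\}^N$), and $v\in\mathbb{R}^N$, $u\circ v$ is the coordinatewise product, $\operatorname{supp}(v)=\{i:v_i\ne0\}$, $H(\mathcal{T},v)=\{i\in N:\exists s\in\mathcal{T}\text{ with }\operatorname{supp}(s\circ v)=\{i\}\}$, and $\mathrm{HHdim}(\mathcal{T})=\sup_{v\in\mathbb{R}^N}|H(\mathcal{T},v)|$.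
   Formalization: The vectors v in the definition of HHdim are taken in ℚ^N rather than ℝ^N. -}

module Defs where

open import Data.Nat using (ℕ; _≤_; _*_)
open import Data.Bool using (Bool; true; false; _∧_; not; _xor_)
open import Data.Fin using (Fin; quotient)
open import Data.Fin.Subset using (Subset; ∣_∣)
open import Data.Fin.Properties using () renaming (_≟_ to _≟ᶠ_)
open import Data.Vec using (lookup; tabulate)
open import Data.List using (List; map; allFin)
open import Data.Bool.ListAction using (all; any)
open import Data.Rational using (ℚ; 0ℚ; _≟_)
open import Data.Product using (Σ; _×_)
open import Relation.Nullary.Decidable using (⌊_⌋)
open import Relation.Binary.PropositionalEquality using (_≡_)

SetSystem : ℕ → Set
SetSystem n = List (Subset n)

_⇔ᵇ_ : Bool → Bool → Bool
a ⇔ᵇ b = not (a xor b)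

inSupp : ∀ {n} → Subset n → (Fin n → ℚ) → Fin n → Bool
inSupp s v j = lookup s j ∧ not ⌊ v j ≟ 0ℚ ⌋

suppIsSingleton : ∀ {n} → Subset n → (Fin n → ℚ) → Fin n → Bool
suppIsSingleton {n} s v i = all (λ j → inSupp s v j ⇔ᵇ ⌊ j ≟ᶠ i ⌋) (allFin n)

H : ∀ {n} → SetSystem n → (Fin n → ℚ) → Subset n
H T v = tabulate (λ i → any (λ s → suppIsSingleton s v i) T)

-- HHdim(T) = d, i.e. d = sup_v |H(T,v)| (the sup is attained, ground set finite)
IsHHdim : ∀ {n} → SetSystem n → ℕ → Set
IsHHdim {n} T d = Σ (Fin n → ℚ) (λ v → ∣ H T v ∣ ≡ d) × ((v : Fin n → ℚ) → ∣ H T v ∣ ≤ d)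

-- Ground set [n] × [m] encoded as Fin (n * m) via Data.Fin.combine / remQuot;
-- the first coordinate of k is  quotient m k.
-- s' = { (i,j) : i ∈ s, j ∈ [m] }
blowUp : ∀ {n} m → Subset n → Subset (n * m)
blowUp {n} m s = tabulate (λ k → lookup s (quotient {n} m k))

blowUpSystem : ∀ {n} m → SetSystem n → SetSystem (n * m)
blowUpSystem m S = map (blowUp m) S

module Submission where

-- A weight vector v on [n] lifts to [n] × [m̄] by putting v on column 0 and 0 elsewhere;
-- then supp (s' ∘ w) = supp (s ∘ v) × {0}, so every i ∈ H(S,v) yields (i,0) ∈ H(S',w).
-- Conversely, from w define v by v_i ≠ 0 iff the row i of w has a nonzero entry. If
-- supp (s' ∘ w) = {(i,j)} then supp (s ∘ v) = {i}, and a row of [n] × [m̄] contains at most one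
-- point of H(S',w): if s' and t' isolate (i,j) and (i,k), then w_(i,j) ≠ 0 and i ∈ t, so
-- (i,j) ∈ supp (t' ∘ w) = {(i,k)}. Counting row by row, each weight vector on one side is
-- dominated by one on the other side, so both sides have the same maximum.

open import Defs
open import Data.Bool using (Bool; true; false; T; if_then_else_)
open import Data.Empty using (⊥-elim)
open import Data.Fin using (Fin; zero; suc; combine; remQuot; _↑ˡ_; _↑ʳ_)
open import Data.Fin.Properties
  using (remQuot-combine; combine-surjective; combine-injectiveˡ; combine-injectiveʳ; any?; 0≢1+n; suc-injective)
  renaming (_≟_ to _≟ᶠ_)
open import Data.Fin.Subset using (Subset; ∣_∣)
open import Data.List using (allFin)
open import Data.Bool.ListAction using (any)
open import Data.List.Relation.Unary.Any as Any using (Any; satisfied)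
import Data.List.Relation.Unary.Any.Properties as Any
import Data.List.Relation.Unary.All.Properties as All
open import Data.Nat using (ℕ; zero; suc; _+_; _*_; _≤_; _<_; z≤n; s≤s)
open import Data.Nat.Properties using (≤-trans; ≤-antisym; ≤-reflexive; +-mono-≤; module ≤-Reasoning)
open import Data.Product using (Σ; ∃; _×_; _,_; proj₁; proj₂; map₁)
open import Data.Rational using (ℚ; 0ℚ; 1ℚ) renaming (_≟_ to _≟ℚ_)
open import Data.Rational.Properties using (1≢0)
open import Data.Vec using (_∷_; []; lookup; tabulate)
open import Data.Vec.Properties using (lookup∘tabulate)
open import Function using (_∘_)
open import Function.Bundles using (_⇔_; mk⇔; Equivalence)
open import Relation.Nullary using (¬_; Dec; yes; no; does; ¬?)
open import Relation.Nullary.Decidable using (⌊_⌋; toWitness; fromWitness)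
open import Relation.Binary.PropositionalEquality using (_≡_; _≢_; refl; sym; trans; cong; subst)

open Equivalence using (to; from)

IsMaximum : ∀ {a} {A : Set a} → (A → ℕ) → ℕ → Set a
IsMaximum {A = A} f d = Σ A (λ x → f x ≡ d) × (∀ x → f x ≤ d)

IsMaximum-transfer : ∀ {a b} {A : Set a} {B : Set b} (f : A → ℕ) (g : B → ℕ) {d : ℕ} →
                     (∀ x → ∃ λ y → f x ≤ g y) → (∀ y → ∃ λ x → g y ≤ f x) →
                     IsMaximum f d → IsMaximum g d
IsMaximum-transfer f g {d} f≼g g≼f ((x , fx≡d) , f≤d) = (y , ≤-antisym (g≤d y) d≤gy) , g≤d
  where
  y = proj₁ (f≼g x)
  d≤gy = subst (_≤ g y) fx≡d (proj₂ (f≼g x))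
  g≤d : ∀ y → g y ≤ d
  g≤d y = ≤-trans (proj₂ (g≼f y)) (f≤d (proj₁ (g≼f y)))

IsMaximum-⇔ : ∀ {a b} {A : Set a} {B : Set b} (f : A → ℕ) (g : B → ℕ) {d : ℕ} →
              (∀ x → ∃ λ y → f x ≤ g y) → (∀ y → ∃ λ x → g y ≤ f x) →
              IsMaximum f d ⇔ IsMaximum g d
IsMaximum-⇔ f g f≼g g≼f = mk⇔ (IsMaximum-transfer f g f≼g g≼f) (IsMaximum-transfer g f g≼f f≼g)

∣x∷p∣≡∣x∷[]∣+∣p∣ : ∀ {n} x (p : Subset n) → ∣ x ∷ p ∣ ≡ ∣ x ∷ [] ∣ + ∣ p ∣
∣x∷p∣≡∣x∷[]∣+∣p∣ true  p = refl
∣x∷p∣≡∣x∷[]∣+∣p∣ false p = refl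

∣tabulate∣-↑ : ∀ a {b} (f : Fin (a + b) → Bool) →
               ∣ tabulate f ∣ ≡ ∣ tabulate (f ∘ (_↑ˡ b)) ∣ + ∣ tabulate (f ∘ (a ↑ʳ_)) ∣
∣tabulate∣-↑ zero    f = refl
∣tabulate∣-↑ (suc a) f with f zero
... | true  = cong suc (∣tabulate∣-↑ a (f ∘ suc))
... | false = ∣tabulate∣-↑ a (f ∘ suc)

∣tabulate∣≡0 : ∀ {m} (r : Fin m → Bool) → (∀ j → ¬ T (r j)) → ∣ tabulate r ∣ ≡ 0
∣tabulate∣≡0 {zero}  r none = refl
∣tabulate∣≡0 {suc m} r none with r zero | none zero
... | true  | ¬t = ⊥-elim (¬t _)
... | false | _  = ∣tabulate∣≡0 (r ∘ suc) (none ∘ suc)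

∣tabulate∣≤1 : ∀ {m} (r : Fin m → Bool) → (∀ j k → T (r j) → T (r k) → j ≡ k) → ∣ tabulate r ∣ ≤ 1
∣tabulate∣≤1 {zero}  r unique = z≤n
∣tabulate∣≤1 {suc m} r unique with r zero in eq
... | true  = s≤s (≤-reflexive (∣tabulate∣≡0 (r ∘ suc) λ j t →
                0≢1+n (unique zero (suc j) (subst T (sym eq) _) t)))
... | false = ∣tabulate∣≤1 (r ∘ suc) λ j k tj tk → suc-injective (unique (suc j) (suc k) tj tk)

0<∣tabulate∣ : ∀ {m} (r : Fin m → Bool) j → T (r j) → 0 < ∣ tabulate r ∣
0<∣tabulate∣ r zero t with r zero | t
... | true | _ = s≤s z≤n
0<∣tabulate∣ r (suc j) t with r zero
... | true  = s≤s z≤n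
... | false = 0<∣tabulate∣ (r ∘ suc) j t

∣b∷[]∣≤∣tabulate∣ : ∀ {m b} (r : Fin m → Bool) j → (T b → T (r j)) → ∣ b ∷ [] ∣ ≤ ∣ tabulate r ∣
∣b∷[]∣≤∣tabulate∣ {b = true}  r j hit = 0<∣tabulate∣ r j (hit _)
∣b∷[]∣≤∣tabulate∣ {b = false} r j hit = z≤n

∣tabulate∣≤∣b∷[]∣ : ∀ {m b} (r : Fin m → Bool) → (∀ j → T (r j) → T b) →
                    (∀ j k → T (r j) → T (r k) → j ≡ k) → ∣ tabulate r ∣ ≤ ∣ b ∷ [] ∣
∣tabulate∣≤∣b∷[]∣ {b = true}  r into unique = ∣tabulate∣≤1 r unique
∣tabulate∣≤∣b∷[]∣ {b = false} r into unique = ≤-reflexive (∣tabulate∣≡0 r into)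

module _ where
  open ≤-Reasoning

  -- f ∘ combine zero is f ∘ (_↑ˡ n * m) and f ∘ combine (suc i) is f ∘ (m ↑ʳ_) ∘ combine i by definition.

  ∣tabulate∣≤-byRows : ∀ {n m} (f : Fin (n * m) → Bool) (g : Fin n → Bool) →
                       (∀ i → ∣ tabulate (f ∘ combine i) ∣ ≤ ∣ g i ∷ [] ∣) →
                       ∣ tabulate f ∣ ≤ ∣ tabulate g ∣
  ∣tabulate∣≤-byRows {zero}      f g rows = z≤n
  ∣tabulate∣≤-byRows {suc n} {m} f g rows = begin
    ∣ tabulate f ∣                                                 ≡⟨ ∣tabulate∣-↑ m f ⟩
    ∣ tabulate (f ∘ (_↑ˡ n * m)) ∣ + ∣ tabulate (f ∘ (m ↑ʳ_)) ∣
      ≤⟨ +-mono-≤ (rows zero) (∣tabulate∣≤-byRows (f ∘ (m ↑ʳ_)) (g ∘ suc) (rows ∘ suc)) ⟩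
    ∣ g zero ∷ [] ∣ + ∣ tabulate (g ∘ suc) ∣                       ≡⟨ ∣x∷p∣≡∣x∷[]∣+∣p∣ (g zero) (tabulate (g ∘ suc)) ⟨
    ∣ tabulate g ∣                                                 ∎

  ∣tabulate∣≥-byRows : ∀ {n m} (f : Fin (n * m) → Bool) (g : Fin n → Bool) →
                       (∀ i → ∣ g i ∷ [] ∣ ≤ ∣ tabulate (f ∘ combine i) ∣) →
                       ∣ tabulate g ∣ ≤ ∣ tabulate f ∣
  ∣tabulate∣≥-byRows {zero}      f g rows = z≤n
  ∣tabulate∣≥-byRows {suc n} {m} f g rows = begin
    ∣ tabulate g ∣                                                 ≡⟨ ∣x∷p∣≡∣x∷[]∣+∣p∣ (g zero) (tabulate (g ∘ suc)) ⟩
    ∣ g zero ∷ [] ∣ + ∣ tabulate (g ∘ suc) ∣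
      ≤⟨ +-mono-≤ (rows zero) (∣tabulate∣≥-byRows (f ∘ (m ↑ʳ_)) (g ∘ suc) (rows ∘ suc)) ⟩
    ∣ tabulate (f ∘ (_↑ˡ n * m)) ∣ + ∣ tabulate (f ∘ (m ↑ʳ_)) ∣   ≡⟨ ∣tabulate∣-↑ m f ⟨
    ∣ tabulate f ∣                                                 ∎

InSupp : ∀ {n} → Subset n → (Fin n → ℚ) → Fin n → Set
InSupp s v j = T (lookup s j) × v j ≢ 0ℚ

SuppIsSingleton : ∀ {n} → Subset n → (Fin n → ℚ) → Fin n → Set
SuppIsSingleton s v i = ∀ j → InSupp s v j ⇔ j ≡ i

inSupp-reflects : ∀ {n} (s : Subset n) (v : Fin n → ℚ) j → T (inSupp s v j) ⇔ InSupp s v j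
inSupp-reflects s v j with lookup s j | v j ≟ℚ 0ℚ
... | true  | yes vj≡0 = mk⇔ (λ ()) (λ (_ , vj≢0) → vj≢0 vj≡0)
... | true  | no vj≢0  = mk⇔ (λ _ → _ , vj≢0) (λ _ → _)
... | false | _        = mk⇔ (λ ()) (λ ())

⇔ᵇ-reflects : ∀ {a b} {A B : Set} → T a ⇔ A → T b ⇔ B → T (a ⇔ᵇ b) ⇔ (A ⇔ B)
⇔ᵇ-reflects {true}  {true}  ra rb = mk⇔ (λ _ → mk⇔ (λ _ → to rb _) (λ _ → to ra _)) (λ _ → _)
⇔ᵇ-reflects {true}  {false} ra rb = mk⇔ (λ ()) (λ a⇔b → from rb (to a⇔b (to ra _)))
⇔ᵇ-reflects {false} {true}  ra rb = mk⇔ (λ ()) (λ a⇔b → from ra (from a⇔b (to rb _)))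
⇔ᵇ-reflects {false} {false} ra rb = mk⇔ (λ _ → mk⇔ (⊥-elim ∘ from ra) (⊥-elim ∘ from rb)) (λ _ → _)

suppIsSingleton-reflects : ∀ {n} (s : Subset n) (v : Fin n → ℚ) i →
                           T (suppIsSingleton s v i) ⇔ SuppIsSingleton s v i
suppIsSingleton-reflects {n} s v i =
  mk⇔ (λ t j → to (reflects j) (All.tabulate⁻ (All.all⁺ test (allFin n) t) j))
      (λ h → All.all⁻ test (All.tabulate⁺ λ j → from (reflects j) (h j)))
  where
  test : Fin n → Bool
  test j = inSupp s v j ⇔ᵇ ⌊ j ≟ᶠ i ⌋
  reflects : ∀ j → T (test j) ⇔ (InSupp s v j ⇔ j ≡ i)
  reflects j = ⇔ᵇ-reflects (inSupp-reflects s v j) (mk⇔ toWitness fromWitness)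

lookup-blowUp : ∀ {n} m (s : Subset n) i j → lookup (blowUp m s) (combine i j) ≡ lookup s i
lookup-blowUp m s i j =
  trans (lookup∘tabulate _ (combine i j)) (cong (lookup s ∘ proj₁) (remQuot-combine i j))

inSupp-blowUp : ∀ {n} m (s : Subset n) (w : Fin (n * m) → ℚ) i j →
                InSupp (blowUp m s) w (combine i j) ⇔ (T (lookup s i) × w (combine i j) ≢ 0ℚ)
inSupp-blowUp m s w i j = mk⇔ (map₁ (subst T eq)) (map₁ (subst T (sym eq)))
  where eq = lookup-blowUp m s i j

lift : ∀ {n} m → (Fin n → ℚ) → Fin (n * suc m) → ℚ
lift {n} m v k with remQuot {n} (suc m) k
... | i , zero  = v i
... | _ , suc _ = 0ℚ

lift-zero : ∀ {n} m (v : Fin n → ℚ) i → lift m v (combine i zero) ≡ v i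
lift-zero {n} m v i rewrite remQuot-combine {n} {suc m} i zero = refl

lift-suc : ∀ {n} m (v : Fin n → ℚ) i (j : Fin m) → lift m v (combine i (suc j)) ≡ 0ℚ
lift-suc {n} m v i j rewrite remQuot-combine {n} {suc m} i (suc j) = refl

lift-suppIsSingleton : ∀ {n} m (s : Subset n) (v : Fin n → ℚ) {i} → SuppIsSingleton s v i →
                       SuppIsSingleton (blowUp (suc m) s) (lift m v) (combine i zero)
lift-suppIsSingleton {n} m s v {i} single k = mk⇔ (isolated k) λ { refl → inSuppᵢ }
  where
  inSuppᵢ : InSupp (blowUp (suc m) s) (lift m v) (combine i zero)
  inSuppᵢ with sᵢ , vᵢ≢0 ← from (single i) refl =
    from (inSupp-blowUp (suc m) s (lift m v) i zero) (sᵢ , vᵢ≢0 ∘ trans (sym (lift-zero m v i)))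
  isolated : ∀ k → InSupp (blowUp (suc m) s) (lift m v) k → k ≡ combine i zero
  isolated k k∈supp with combine-surjective {n} {suc m} k
  ... | a , b , refl with sₐ , w≢0 ← to (inSupp-blowUp (suc m) s (lift m v) a b) k∈supp with b
  ... | zero  = cong (λ a → combine a zero) (to (single a) (sₐ , w≢0 ∘ trans (lift-zero m v a)))
  ... | suc b = ⊥-elim (w≢0 (lift-suc m v a b))

rowIsNonzero? : ∀ {n} m (w : Fin (n * m) → ℚ) (a : Fin n) → Dec (∃ λ (j : Fin m) → w (combine a j) ≢ 0ℚ)
rowIsNonzero? m w a = any? λ j → ¬? (w (combine a j) ≟ℚ 0ℚ)

project : ∀ {n} m → (Fin (n * m) → ℚ) → Fin n → ℚ
project m w a = if does (rowIsNonzero? m w a) then 1ℚ else 0ℚ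

project-≢0 : ∀ {n} m (w : Fin (n * m) → ℚ) (a : Fin n) → project m w a ≢ 0ℚ ⇔ ∃ λ (j : Fin m) → w (combine a j) ≢ 0ℚ
project-≢0 m w a with rowIsNonzero? m w a
... | yes row = mk⇔ (λ _ → row) (λ _ → 1≢0)
... | no ¬row = mk⇔ (λ 0≢0 → ⊥-elim (0≢0 refl)) (⊥-elim ∘ ¬row)

project-suppIsSingleton : ∀ {n} m (s : Subset n) (w : Fin (n * m) → ℚ) {i : Fin n} {j : Fin m} →
                          SuppIsSingleton (blowUp m s) w (combine i j) → SuppIsSingleton s (project m w) i
project-suppIsSingleton m s w {i} {j} single a = mk⇔ isolated λ { refl → inSuppᵢ }
  where
  inSuppᵢ : InSupp s (project m w) i
  inSuppᵢ with sᵢ , wᵢⱼ≢0 ← to (inSupp-blowUp m s w i j) (from (single (combine i j)) refl) =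
    sᵢ , from (project-≢0 m w i) (j , wᵢⱼ≢0)
  isolated : InSupp s (project m w) a → a ≡ i
  isolated (sₐ , vₐ≢0) with b , wₐᵦ≢0 ← to (project-≢0 m w a) vₐ≢0 =
    combine-injectiveˡ a b i j (to (single (combine a b)) (from (inSupp-blowUp m s w a b) (sₐ , wₐᵦ≢0)))

blowUp-rowUnique : ∀ {n} m (s t : Subset n) (w : Fin (n * m) → ℚ) {i j k} →
                   SuppIsSingleton (blowUp m s) w (combine i j) →
                   SuppIsSingleton (blowUp m t) w (combine i k) → j ≡ k
blowUp-rowUnique m s t w {i} {j} {k} singleⱼ singleₖ =
  combine-injectiveʳ i j i k (to (singleₖ (combine i j)) (from (inSupp-blowUp m t w i j) (tᵢ , wᵢⱼ≢0)))
  where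
  tᵢ = proj₁ (to (inSupp-blowUp m t w i k) (from (singleₖ (combine i k)) refl))
  wᵢⱼ≢0 = proj₂ (to (inSupp-blowUp m s w i j) (from (singleⱼ (combine i j)) refl))

inH : ∀ {n} → SetSystem n → (Fin n → ℚ) → Fin n → Bool
inH S v i = any (λ s → suppIsSingleton s v i) S

inH-reflects : ∀ {n} (S : SetSystem n) (v : Fin n → ℚ) i →
               T (inH S v i) ⇔ Any (λ s → SuppIsSingleton s v i) S
inH-reflects S v i =
  mk⇔ (Any.map (λ {s} → to (suppIsSingleton-reflects s v i)) ∘ Any.any⁻ _ S)
      (Any.any⁺ _ ∘ Any.map (λ {s} → from (suppIsSingleton-reflects s v i)))

lift-inH : ∀ {n} m (S : SetSystem n) (v : Fin n → ℚ) i →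
           T (inH S v i) → T (inH (blowUpSystem (suc m) S) (lift m v) (combine i zero))
lift-inH m S v i =
  from (inH-reflects (blowUpSystem (suc m) S) (lift m v) (combine i zero))
  ∘ Any.map⁺ ∘ Any.map (λ {s} → lift-suppIsSingleton m s v) ∘ to (inH-reflects S v i)

project-inH : ∀ {n} m (S : SetSystem n) (w : Fin (n * m) → ℚ) (i : Fin n) (j : Fin m) →
              T (inH (blowUpSystem m S) w (combine i j)) → T (inH S (project m w) i)
project-inH m S w i j =
  from (inH-reflects S (project m w) i)
  ∘ Any.map (λ {s} → project-suppIsSingleton m s w) ∘ Any.map⁻ ∘ to (inH-reflects (blowUpSystem m S) w (combine i j))

inH-blowUp-rowUnique : ∀ {n} m (S : SetSystem n) (w : Fin (n * m) → ℚ) (i : Fin n) (j k : Fin m) →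
                       T (inH (blowUpSystem m S) w (combine i j)) →
                       T (inH (blowUpSystem m S) w (combine i k)) → j ≡ k
inH-blowUp-rowUnique m S w i j k hitⱼ hitₖ =
  let s , singleⱼ = witness j hitⱼ
      t , singleₖ = witness k hitₖ
  in  blowUp-rowUnique m s t w singleⱼ singleₖ
  where
  witness : ∀ j → T (inH (blowUpSystem m S) w (combine i j)) →
            ∃ λ s → SuppIsSingleton (blowUp m s) w (combine i j)
  witness j = satisfied ∘ Any.map⁻ ∘ to (inH-reflects (blowUpSystem m S) w (combine i j))

∣H∣≤∣H-blowUp-lift∣ : ∀ {n} m (S : SetSystem n) (v : Fin n → ℚ) →
                      ∣ H S v ∣ ≤ ∣ H (blowUpSystem (suc m) S) (lift m v) ∣
∣H∣≤∣H-blowUp-lift∣ m S v =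
  ∣tabulate∣≥-byRows (inH (blowUpSystem (suc m) S) (lift m v)) (inH S v)
    λ i → ∣b∷[]∣≤∣tabulate∣ (inH (blowUpSystem (suc m) S) (lift m v) ∘ combine i) zero (lift-inH m S v i)

∣H-blowUp∣≤∣H-project∣ : ∀ {n} m (S : SetSystem n) (w : Fin (n * m) → ℚ) →
                         ∣ H (blowUpSystem m S) w ∣ ≤ ∣ H S (project m w) ∣
∣H-blowUp∣≤∣H-project∣ m S w =
  ∣tabulate∣≤-byRows (inH (blowUpSystem m S) w) (inH S (project m w))
    λ i → ∣tabulate∣≤∣b∷[]∣ (inH (blowUpSystem m S) w ∘ combine i) (project-inH m S w i) (inH-blowUp-rowUnique m S w i)

mainTheorem18 : (n m : ℕ) → 1 ≤ m → (S : SetSystem n) → (d : ℕ) →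
                IsHHdim S d ⇔ IsHHdim (blowUpSystem m S) d
mainTheorem18 n (suc m) _ S d =
  IsMaximum-⇔ (λ v → ∣ H S v ∣) (λ w → ∣ H (blowUpSystem (suc m) S) w ∣)
    (λ v → lift m v , ∣H∣≤∣H-blowUp-lift∣ m S v)
    (λ w → project (suc m) w , ∣H-blowUp∣≤∣H-project∣ (suc m) S w)
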